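{- Let $\Sigma\in\mathcal{G}_n$ and $Q\in\mathcal{Q}(\Sigma)$ with level $\ell$. Let $p$ be a prime divisor of $\ell$. Then there exists an integral vector $z\not\equiv 0\pmod p$ such that $W(\Sigma)^{\rm T}z\equiv 0\pmod p$.
   Context: An oriented graph $\Sigma$ on vertices $v_1,\dots,v_n$ is a simple graph with each edge given a direction. Its skew-adjacency matrix $S(\Sigma)=(s_{ij})$ has $s_{ij}=1$ if $(v_i,v_j)$ is an arc, $s_{ij}=-1$ if $(v_j,v_i)$ is an arc, and $0$ otherwise. Two oriented graphs are generalized cospectral if their skew-adjacency matrices $S$ have the same spectrum and the matrices $J-I-S$ have the same spectrum ($J$ all-one). The skew-walk matrix is $W(\Sigma)=[e,Se,\dots,S^{n-1}e]$ with $S=S(\Sigma)$, $e$ the all-one vector. $\mathcal{G}_n$ is the set of $n$-vertex oriented graphs $\Sigma$ such that $2^{ -\lfloor n/2\rfloor}\det W(\Sigma)$ is an odd square-free integer. A rational orthogonal matrix $Q$ is regular if $Qe=e$; its level is the smallest positive integer $k$ with $kQ$ integral. $\mathcal{Q}(\Sigma)$ is the set of regular rational orthogonal matrices $Q$ such that $Q^{\rm T}S(\Sigma)Q=S(\Delta)$ for some oriented graph $\Delta$ generalized cospectral with $\Sigma$. -}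

module Defs where

open import Data.Bool using (Bool; true; false; if_then_else_)
open import Data.Nat as ℕ using (ℕ; zero; suc; ⌊_/2⌋) renaming (_^_ to _^ℕ_)
import Data.Nat.Divisibility as ℕD
open import Data.Nat.Primality using (Prime)
open import Data.Fin using (Fin; zero; suc; toℕ; punchIn; _≟_)
open import Data.List using (List; []; _∷_; map)
open import Data.Integer as ℤ using (ℤ; +_; ∣_∣)
open import Data.Integer.Divisibility as ℤD using ()
open import Data.Rational as ℚ using (ℚ)
open import Data.Product using (Σ; _×_; ∃; _,_)
open import Relation.Binary.PropositionalEquality using (_≡_)
open import Relation.Nullary using (¬_; does)

record RingOps (A : Set) : Set where
  field
    zero# one# : A
    add mul : A → A → A
    neg : A → A

Mat : Set → ℕ → Set
Mat A n = Fin n → Fin n → A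

Vec′ : Set → ℕ → Set
Vec′ A n = Fin n → A

module Generic {A : Set} (R : RingOps A) where
  open RingOps R

  sumFin : ∀ n → (Fin n → A) → A
  sumFin zero    f = zero#
  sumFin (suc n) f = add (f zero) (sumFin n (λ i → f (suc i)))

  sign : ℕ → A
  sign zero          = one#
  sign (suc zero)    = neg one#
  sign (suc (suc k)) = sign k

  minor : ∀ {m} → Fin (suc m) → Mat A (suc m) → Mat A m
  minor j M i k = M (suc i) (punchIn j k)

  det : ∀ n → Mat A n → A
  det zero    M = one#
  det (suc m) M = sumFin (suc m) (λ j → mul (sign (toℕ j)) (mul (M zero j) (det m (minor j M))))

  _⊗_ : ∀ {n} → Mat A n → Mat A n → Mat A n
  (M ⊗ N) i j = sumFin _ (λ k → mul (M i k) (N k j))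

  _⊛_ : ∀ {n} → Mat A n → Vec′ A n → Vec′ A n
  (M ⊛ v) i = sumFin _ (λ k → mul (M i k) (v k))

  transpose : ∀ {n} → Mat A n → Mat A n
  transpose M i j = M j i

  idMat : ∀ {n} → Mat A n
  idMat i j = if does (i ≟ j) then one# else zero#

  ones : ∀ {n} → Vec′ A n
  ones _ = one#

  powApply : ∀ {n} → ℕ → Mat A n → Vec′ A n → Vec′ A n
  powApply zero    M v = v
  powApply (suc k) M v = M ⊛ powApply k M v

ℤOps : RingOps ℤ
ℤOps = record { zero# = + 0 ; one# = + 1 ; add = ℤ._+_ ; mul = ℤ._*_ ; neg = ℤ.-_ }

ℚOps : RingOps ℚ
ℚOps = record { zero# = ℚ.0ℚ ; one# = ℚ.1ℚ ; add = ℚ._+_ ; mul = ℚ._*_ ; neg = ℚ.-_ }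

-- integer polynomials as coefficient lists (lowest degree first)
Poly : Set
Poly = List ℤ

addP : Poly → Poly → Poly
addP []       q        = q
addP (a ∷ p)  []       = a ∷ p
addP (a ∷ p)  (b ∷ q)  = (a ℤ.+ b) ∷ addP p q

mulP : Poly → Poly → Poly
mulP []      q = []
mulP (a ∷ p) q = addP (map (a ℤ.*_) q) (+ 0 ∷ mulP p q)

PolyOps : RingOps Poly
PolyOps = record { zero# = [] ; one# = + 1 ∷ [] ; add = addP ; mul = mulP ; neg = map (λ a → ℤ.- a) }

coeff : Poly → ℕ → ℤ
coeff []      _       = + 0
coeff (a ∷ p) zero    = a
coeff (a ∷ p) (suc k) = coeff p k

_≈P_ : Poly → Poly → Set
p ≈P q = ∀ k → coeff p k ≡ coeff q k

module Zm = Generic ℤOps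
module Qm = Generic ℚOps
module Pm = Generic PolyOps

-- characteristic polynomial det(xI - M) of an integer matrix
charPoly : ∀ {n} → Mat ℤ n → Poly
charPoly {n} M = Pm.det n (λ i j →
  addP (if does (i ≟ j) then (+ 0 ∷ + 1 ∷ []) else []) ((ℤ.- M i j) ∷ []))

Cospectral : ∀ {n} → Mat ℤ n → Mat ℤ n → Set
Cospectral M N = charPoly M ≈P charPoly N

record OrientedGraph (n : ℕ) : Set where
  field
    arc     : Fin n → Fin n → Bool
    irrefl  : ∀ i → arc i i ≡ false
    oriented : ∀ i j → arc i j ≡ true → arc j i ≡ false
open OrientedGraph public

skewAdj : ∀ {n} → OrientedGraph n → Mat ℤ n
skewAdj G i j = if arc G i j then + 1 else (if arc G j i then ℤ.- (+ 1) else + 0)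

complSkew : ∀ {n} → Mat ℤ n → Mat ℤ n
complSkew M i j = (+ 1 ℤ.- Zm.idMat i j) ℤ.- M i j

GenCospectral : ∀ {n} → OrientedGraph n → OrientedGraph n → Set
GenCospectral G D =
  Cospectral (skewAdj G) (skewAdj D) × Cospectral (complSkew (skewAdj G)) (complSkew (skewAdj D))

walkMat : ∀ {n} → OrientedGraph n → Mat ℤ n
walkMat G i k = Zm.powApply (toℕ k) (skewAdj G) Zm.ones i

-- square-free integer (in particular nonzero, since every m*m divides 0)
SquareFree : ℤ → Set
SquareFree d = ∀ m → (m ℕ.* m) ℕD.∣ ∣ d ∣ → m ≡ 1

OddInt : ℤ → Set
OddInt d = ¬ (2 ℕD.∣ ∣ d ∣)

InG : ∀ n → OrientedGraph n → Set
InG n G = ∃ (λ (d : ℤ) → (Zm.det n (walkMat G) ≡ (+ (2 ^ℕ ⌊ n /2⌋)) ℤ.* d) × OddInt d × SquareFree d)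

toℚMat : ∀ {n} → Mat ℤ n → Mat ℚ n
toℚMat M i j = M i j ℚ./ 1

Orthogonal : ∀ {n} → Mat ℚ n → Set
Orthogonal Q = ∀ i j → Qm._⊗_ (Qm.transpose Q) Q i j ≡ Qm.idMat i j

Regular : ∀ {n} → Mat ℚ n → Set
Regular Q = ∀ i → Qm._⊛_ Q Qm.ones i ≡ ℚ.1ℚ

IsIntegral : ℚ → Set
IsIntegral q = ℚ.denominatorℕ q ≡ 1

ScaledIntegral : ∀ {n} → ℕ → Mat ℚ n → Set
ScaledIntegral k Q = ∀ i j → IsIntegral ((+ k ℚ./ 1) ℚ.* Q i j)

IsLevel : ∀ {n} → Mat ℚ n → ℕ → Set
IsLevel Q ℓ = (0 ℕ.< ℓ) × ScaledIntegral ℓ Q × (∀ k → 0 ℕ.< k → ScaledIntegral k Q → ℓ ℕ.≤ k)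

InQ : ∀ {n} → OrientedGraph n → Mat ℚ n → Set
InQ {n} G Q = Orthogonal Q × Regular Q ×
  ∃ (λ (D : OrientedGraph n) → GenCospectral G D ×
     (∀ i j → Qm._⊗_ (Qm._⊗_ (Qm.transpose Q) (toℚMat (skewAdj G))) Q i j ≡ toℚMat (skewAdj D) i j))

_∣ℤ_ : ℕ → ℤ → Set
p ∣ℤ x = p ℕD.∣ ∣ x ∣

-- Since Q is regular and orthogonal, Qᵀe = e, and once QQᵀ = I is known the
-- relation QᵀS(Σ)Q = S(Δ) becomes QᵀS(Σ) = S(Δ)Qᵀ; hence QᵀW(Σ) = W(Δ), that is
-- W(Σ)ᵀ(ℓQ) = ℓW(Δ)ᵀ ≡ 0 (mod p). If every entry of the integral matrix ℓQ were
-- divisible by p, then (ℓ/p)Q would be integral, contradicting the minimality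
-- of ℓ; so some column z of ℓQ is not ≡ 0 (mod p). The identity QQᵀ = I for a
-- square rational matrix with QᵀQ = I is derived constructively from the fact
-- that n + 1 vectors in ℚⁿ are linearly dependent (fraction-free elimination).
module Submission where

open import Defs
open import Data.Nat using (ℕ)
open import Data.Nat.Primality using (Prime; prime)
open import Data.Nat.Divisibility using (_∣_)
open import Data.Integer using (ℤ)
open import Data.Rational using (ℚ)
open import Data.Product using (Σ; _×_)
open import Relation.Nullary using (¬_)

open import Algebra.Bundles using (Ring)
open import Data.Fin using (Fin; zero; suc; toℕ; punchIn)
open import Data.Fin.Properties using (any?)
open import Data.Integer as ℤ using (∣_∣)
import Data.Integer.Divisibility.Signed as ℤD
import Data.Integer.Properties as ℤP
open import Data.Maybe using (nothing)
open import Data.Nat as ℕ using (zero; suc; NonTrivial)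
open import Data.Nat.Coprimality as Coprime using ()
import Data.Nat.Divisibility as ℕD
import Data.Nat.Properties as ℕP
open import Data.Product using (_,_; ∃; ∃₂; proj₁; proj₂)
open import Data.Rational as ℚ using (_+_; _*_; -_; 0ℚ; 1ℚ; 1/_; ↥_; _/_)
import Data.Rational.Properties as ℚP
open import Data.Vec.Functional using (Vector; _∷_; insertAt)
open import Data.Vec.Functional.Properties using (insertAt-lookup; insertAt-punchIn)
open import Function using (_∘_)
open import Relation.Binary.PropositionalEquality
open import Relation.Nullary using (contradiction)
open import Relation.Nullary.Decidable using (yes; no; ¬?; decidable-stable)
open import Tactic.RingSolver using (solve-∀)
open import Tactic.RingSolver.Core.AlmostCommutativeRing using (AlmostCommutativeRing; fromCommutativeRing)

open import Algebra.Properties.Group (Ring.+-group ℚP.+-*-ring) using (x∙y⁻¹≈ε⇒x≈y)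
open import Algebra.Properties.Ring ℚP.+-*-ring using (-1*x≈-x)
open import Algebra.Properties.Semiring.Sum (Ring.semiring ℚP.+-*-ring)
  using (sum; sum-syntax; sum-cong-≗; sum-remove; sum-replicate-zero; ∑-distrib-+; ∑-comm; *-distribˡ-sum; *-distribʳ-sum)
open Qm using (transpose; idMat; ones)

ℚ-ring : AlmostCommutativeRing _ _
ℚ-ring = fromCommutativeRing ℚP.+-*-commutativeRing (λ _ → nothing)

*-cancelˡ-≡ : ∀ p {q r} → p ≢ 0ℚ → p * q ≡ p * r → q ≡ r
*-cancelˡ-≡ p {q} {r} p≢0 eq = begin
  q               ≡⟨ sym (ℚP.*-identityˡ q) ⟩
  1ℚ * q          ≡⟨ cong (_* q) (sym (ℚP.*-inverseˡ p)) ⟩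
  (1/ p * p) * q  ≡⟨ ℚP.*-assoc (1/ p) p q ⟩
  1/ p * (p * q)  ≡⟨ cong (1/ p *_) eq ⟩
  1/ p * (p * r)  ≡⟨ sym (ℚP.*-assoc (1/ p) p r) ⟩
  (1/ p * p) * r  ≡⟨ cong (_* r) (ℚP.*-inverseˡ p) ⟩
  1ℚ * r          ≡⟨ ℚP.*-identityˡ r ⟩
  r               ∎
  where
  open ≡-Reasoning
  instance _ = ℚ.≢-nonZero p≢0

p≢0∧q≢0⇒p*q≢0 : ∀ {p q} → p ≢ 0ℚ → q ≢ 0ℚ → p * q ≢ 0ℚ
p≢0∧q≢0⇒p*q≢0 {p} p≢0 q≢0 pq≡0 = q≢0 (*-cancelˡ-≡ p p≢0 (trans pq≡0 (sym (ℚP.*-zeroʳ p))))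

-1*p+p≡0 : ∀ p → - 1ℚ * p + p ≡ 0ℚ
-1*p+p≡0 p = trans (cong (_+ p) (-1*x≈-x p)) (ℚP.+-inverseˡ p)

-1*p+q≡0⇒q≡p : ∀ p q → - 1ℚ * p + q ≡ 0ℚ → q ≡ p
-1*p+q≡0⇒q≡p p q eq = x∙y⁻¹≈ε⇒x≈y q p (trans (ℚP.+-comm q (- p)) (trans (cong (_+ q) (sym (-1*x≈-x p))) eq))

record Dependency {m} (v : Fin (suc m) → Fin m → ℚ) : Set where
  field
    weight               : Fin (suc m) → ℚ
    weight-nonzero       : ∃ λ i → weight i ≢ 0ℚ
    combination-vanishes : ∀ r → ∑[ i < suc m ] (weight i * v i r) ≡ 0ℚ

dependency-zero-column : ∀ {m} (v : Fin (suc (suc m)) → Fin (suc m) → ℚ) →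
  (∀ i → v i zero ≡ 0ℚ) → Dependency (λ i r → v (suc i) (suc r)) → Dependency v
dependency-zero-column {m} v v·0≡0 d = record
  { weight               = 0ℚ ∷ weight
  ; weight-nonzero       = suc (proj₁ weight-nonzero) , proj₂ weight-nonzero
  ; combination-vanishes = vanishes
  }
  where
  open Dependency d

  vanishes : ∀ r → ∑[ i < suc (suc m) ] ((0ℚ ∷ weight) i * v i r) ≡ 0ℚ
  vanishes zero = begin
    0ℚ * v zero zero + ∑[ i < suc m ] (weight i * v (suc i) zero)
      ≡⟨ cong₂ _+_ (ℚP.*-zeroˡ (v zero zero))
                   (sum-cong-≗ λ i → trans (cong (weight i *_) (v·0≡0 (suc i))) (ℚP.*-zeroʳ (weight i))) ⟩
    0ℚ + ∑[ i < suc m ] 0ℚ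
      ≡⟨ trans (ℚP.+-identityˡ (∑[ i < suc m ] 0ℚ)) (sum-replicate-zero (suc m)) ⟩
    0ℚ ∎
    where open ≡-Reasoning
  vanishes (suc r) = trans (cong₂ _+_ (ℚP.*-zeroˡ (v zero (suc r))) (combination-vanishes r)) (ℚP.+-identityˡ 0ℚ)

module _ {m} (v : Fin (suc (suc m)) → Fin (suc m) → ℚ) (k : Fin (suc (suc m))) where

  -- Clears the first column against the pivot row k without dividing by v k zero.
  eliminated : Fin (suc m) → Fin (suc m) → ℚ
  eliminated i r = v k zero * v (punchIn k i) r + - v (punchIn k i) zero * v k r

  eliminated-first-column : ∀ i → eliminated i zero ≡ 0ℚ
  eliminated-first-column i = begin
    v k zero * b + - b * v k zero    ≡⟨ cong₂ _+_ (ℚP.*-comm (v k zero) b) (sym (ℚP.neg-distribˡ-* b (v k zero))) ⟩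
    b * v k zero + - (b * v k zero)  ≡⟨ ℚP.+-inverseʳ (b * v k zero) ⟩
    0ℚ                               ∎
    where
    open ≡-Reasoning
    b = v (punchIn k i) zero

  dependency-pivot : v k zero ≢ 0ℚ → Dependency (λ i r → eliminated i (suc r)) → Dependency v
  dependency-pivot pivot≢0 d = record
    { weight               = weight′
    ; weight-nonzero       = punchIn k i₀ , λ w≡0 →
        p≢0∧q≢0⇒p*q≢0 wᵢ₀≢0 pivot≢0 (trans (sym (insertAt-punchIn scaled k x i₀)) w≡0)
    ; combination-vanishes = vanishes
    }
    where
    open Dependency d
    i₀   = proj₁ weight-nonzero
    wᵢ₀≢0 = proj₂ weight-nonzero

    scaled : Fin (suc m) → ℚ
    scaled i = weight i * v k zero

    x : ℚ
    x = ∑[ i < suc m ] (weight i * - v (punchIn k i) zero)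

    weight′ : Fin (suc (suc m)) → ℚ
    weight′ = insertAt scaled k x

    regroup : ∀ a b c p y → (a * - b) * c + (a * p) * y ≡ a * (p * y + - b * c)
    regroup = solve-∀ ℚ-ring

    combination : ∀ r → ∑[ i < suc (suc m) ] (weight′ i * v i r) ≡ ∑[ i < suc m ] (weight i * eliminated i r)
    combination r = begin
      ∑[ i < suc (suc m) ] (weight′ i * v i r)
        ≡⟨ sum-remove {i = k} (λ i → weight′ i * v i r) ⟩
      weight′ k * v k r + ∑[ i < suc m ] (weight′ (punchIn k i) * v (punchIn k i) r)
        ≡⟨ cong₂ _+_ (cong (_* v k r) (insertAt-lookup scaled k x))
                     (sum-cong-≗ λ i → cong (_* v (punchIn k i) r) (insertAt-punchIn scaled k x i)) ⟩
      x * v k r + ∑[ i < suc m ] (scaled i * v (punchIn k i) r)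
        ≡⟨ cong (_+ ∑[ i < suc m ] (scaled i * v (punchIn k i) r))
                (*-distribʳ-sum (v k r) (λ i → weight i * - v (punchIn k i) zero)) ⟩
      ∑[ i < suc m ] ((weight i * - v (punchIn k i) zero) * v k r) + ∑[ i < suc m ] (scaled i * v (punchIn k i) r)
        ≡⟨ sym (∑-distrib-+ (λ i → (weight i * - v (punchIn k i) zero) * v k r) (λ i → scaled i * v (punchIn k i) r)) ⟩
      ∑[ i < suc m ] ((weight i * - v (punchIn k i) zero) * v k r + scaled i * v (punchIn k i) r)
        ≡⟨ sum-cong-≗ (λ i → regroup (weight i) (v (punchIn k i) zero) (v k r) (v k zero) (v (punchIn k i) r)) ⟩
      ∑[ i < suc m ] (weight i * eliminated i r) ∎
      where open ≡-Reasoning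

    vanishes : ∀ r → ∑[ i < suc (suc m) ] (weight′ i * v i r) ≡ 0ℚ
    vanishes zero    = trans (combination zero) (trans (sum-cong-≗ λ i →
      trans (cong (weight i *_) (eliminated-first-column i)) (ℚP.*-zeroʳ (weight i))) (sum-replicate-zero (suc m)))
    vanishes (suc r) = trans (combination (suc r)) (combination-vanishes r)

dependency : ∀ m (v : Fin (suc m) → Fin m → ℚ) → Dependency v
dependency zero    v = record { weight = λ _ → 1ℚ ; weight-nonzero = zero , ℚP.1≢0 ; combination-vanishes = λ () }
dependency (suc m) v with any? (λ i → ¬? (v i zero ℚ.≟ 0ℚ))
... | yes (k , vₖ₀≢0) = dependency-pivot v k vₖ₀≢0 (dependency m _)
... | no  no-pivot    = dependency-zero-column v
  (λ i → decidable-stable (v i zero ℚ.≟ 0ℚ) (λ vᵢ₀≢0 → no-pivot (i , vᵢ₀≢0))) (dependency m _)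

infixr 7 _*ᵥ_
infixl 7 _*ₘ_

_*ᵥ_ : ∀ {n} → Mat ℚ n → Vector ℚ n → Vector ℚ n
(M *ᵥ u) i = ∑[ k < _ ] (M i k * u k)

_*ₘ_ : ∀ {n} → Mat ℚ n → Mat ℚ n → Mat ℚ n
(M *ₘ N) i j = ∑[ k < _ ] (M i k * N k j)

*ᵥ-cong : ∀ {n} (M : Mat ℚ n) {u w : Vector ℚ n} → u ≗ w → M *ᵥ u ≗ M *ᵥ w
*ᵥ-cong M u≗w i = sum-cong-≗ λ k → cong (M i k *_) (u≗w k)

*ᵥ-zero : ∀ {n} (M : Mat ℚ n) → M *ᵥ (λ _ → 0ℚ) ≗ (λ _ → 0ℚ)
*ᵥ-zero {n} M i = trans (sum-cong-≗ λ k → ℚP.*-zeroʳ (M i k)) (sum-replicate-zero n)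

*ᵥ-linear : ∀ {n} (M : Mat ℚ n) a (u w : Vector ℚ n) →
  M *ᵥ (λ r → a * u r + w r) ≗ (λ i → a * (M *ᵥ u) i + (M *ᵥ w) i)
*ᵥ-linear M a u w i = begin
  ∑[ k < _ ] (M i k * (a * u k + w k))          ≡⟨ sum-cong-≗ (λ k → distribute (M i k) a (u k) (w k)) ⟩
  ∑[ k < _ ] (a * (M i k * u k) + M i k * w k)  ≡⟨ ∑-distrib-+ (λ k → a * (M i k * u k)) (λ k → M i k * w k) ⟩
  ∑[ k < _ ] (a * (M i k * u k)) + (M *ᵥ w) i   ≡⟨ cong (_+ (M *ᵥ w) i) (sym (*-distribˡ-sum a (λ k → M i k * u k))) ⟩
  a * (M *ᵥ u) i + (M *ᵥ w) i                   ∎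
  where
  open ≡-Reasoning
  distribute : ∀ m a u w → m * (a * u + w) ≡ a * (m * u) + m * w
  distribute = solve-∀ ℚ-ring

*ᵥ-assoc : ∀ {n} (M N : Mat ℚ n) (w : Vector ℚ n) → M *ᵥ N *ᵥ w ≗ (M *ₘ N) *ᵥ w
*ᵥ-assoc {n} M N w i = begin
  ∑[ a < n ] (M i a * ∑[ k < n ] (N a k * w k))  ≡⟨ sum-cong-≗ (λ a → *-distribˡ-sum (M i a) (λ k → N a k * w k)) ⟩
  ∑[ a < n ] ∑[ k < n ] (M i a * (N a k * w k))  ≡⟨ ∑-comm (λ a k → M i a * (N a k * w k)) ⟩
  ∑[ k < n ] ∑[ a < n ] (M i a * (N a k * w k))  ≡⟨ sum-cong-≗ (λ k → sum-cong-≗ (λ a → sym (ℚP.*-assoc (M i a) (N a k) (w k)))) ⟩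
  ∑[ k < n ] ∑[ a < n ] (M i a * N a k * w k)    ≡⟨ sum-cong-≗ (λ k → sym (*-distribʳ-sum (w k) (λ a → M i a * N a k))) ⟩
  ∑[ k < n ] ((M *ₘ N) i k * w k)                ∎
  where open ≡-Reasoning

sum-idMat : ∀ {n} (i : Fin n) (w : Vector ℚ n) → ∑[ k < n ] (idMat i k * w k) ≡ w i
sum-idMat {suc n} zero    w = begin
  1ℚ * w zero + ∑[ k < n ] (0ℚ * w (suc k))
    ≡⟨ cong₂ _+_ (ℚP.*-identityˡ (w zero)) (sum-cong-≗ λ k → ℚP.*-zeroˡ (w (suc k))) ⟩
  w zero + ∑[ k < n ] 0ℚ
    ≡⟨ trans (cong (w zero +_) (sum-replicate-zero n)) (ℚP.+-identityʳ (w zero)) ⟩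
  w zero ∎
  where open ≡-Reasoning
sum-idMat {suc n} (suc i) w = trans (cong₂ _+_ (ℚP.*-zeroˡ (w zero)) (sum-idMat i (w ∘ suc))) (ℚP.+-identityˡ (w (suc i)))

module OrthogonalMatrix {n} (Q : Mat ℚ n) (orthogonal : ∀ i j → (transpose Q *ₘ Q) i j ≡ idMat i j) where

  Qᵀ : Mat ℚ n
  Qᵀ = transpose Q

  left-inverse : ∀ w → Qᵀ *ᵥ Q *ᵥ w ≗ w
  left-inverse w j = begin
    (Qᵀ *ᵥ Q *ᵥ w) j             ≡⟨ *ᵥ-assoc Qᵀ Q w j ⟩
    ((Qᵀ *ₘ Q) *ᵥ w) j           ≡⟨ sum-cong-≗ (λ k → cong (_* w k) (orthogonal j k)) ⟩
    ∑[ k < n ] (idMat j k * w k)  ≡⟨ sum-idMat j w ⟩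
    w j                           ∎
    where open ≡-Reasoning

  -- Take a dependency among v and the columns of Q: applying Qᵀ to it shows
  -- that the weights of the columns vanish, so the weight of v does not.
  transpose-injective : ∀ v → Qᵀ *ᵥ v ≗ (λ _ → 0ℚ) → v ≗ (λ _ → 0ℚ)
  transpose-injective v Qᵀv≡0 r = *-cancelˡ-≡ c₀ c₀≢0 (begin
    c₀ * v r               ≡⟨ sym (ℚP.+-identityʳ (c₀ * v r)) ⟩
    c₀ * v r + 0ℚ          ≡⟨ cong (c₀ * v r +_) (sym (trans (*ᵥ-cong Q c≡0 r) (*ᵥ-zero Q r))) ⟩
    c₀ * v r + (Q *ᵥ c) r  ≡⟨ relation r ⟩
    0ℚ                     ≡⟨ sym (ℚP.*-zeroʳ c₀) ⟩
    c₀ * 0ℚ                ∎)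
    where
    open ≡-Reasoning
    open Dependency (dependency n (v ∷ Qᵀ))
    c₀ = weight zero
    c  = weight ∘ suc

    relation : ∀ r → c₀ * v r + (Q *ᵥ c) r ≡ 0ℚ
    relation r = trans (cong (c₀ * v r +_) (sum-cong-≗ λ i → ℚP.*-comm (Q r i) (c i))) (combination-vanishes r)

    c≡0 : c ≗ (λ _ → 0ℚ)
    c≡0 j = begin
      c j                                      ≡⟨ sym (left-inverse c j) ⟩
      (Qᵀ *ᵥ Q *ᵥ c) j                         ≡⟨ sym (ℚP.+-identityˡ _) ⟩
      0ℚ + (Qᵀ *ᵥ Q *ᵥ c) j                    ≡⟨ cong (_+ (Qᵀ *ᵥ Q *ᵥ c) j) (sym (trans (cong (c₀ *_) (Qᵀv≡0 j)) (ℚP.*-zeroʳ c₀))) ⟩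
      c₀ * (Qᵀ *ᵥ v) j + (Qᵀ *ᵥ Q *ᵥ c) j      ≡⟨ sym (*ᵥ-linear Qᵀ c₀ v (Q *ᵥ c) j) ⟩
      (Qᵀ *ᵥ (λ r → c₀ * v r + (Q *ᵥ c) r)) j  ≡⟨ *ᵥ-cong Qᵀ relation j ⟩
      (Qᵀ *ᵥ (λ _ → 0ℚ)) j                     ≡⟨ *ᵥ-zero Qᵀ j ⟩
      0ℚ                                       ∎

    c₀≢0 : c₀ ≢ 0ℚ
    c₀≢0 with weight-nonzero
    ... | zero  , w₀≢0 = w₀≢0
    ... | suc j , wⱼ≢0 = contradiction (c≡0 j) wⱼ≢0

  right-inverse : ∀ u → Q *ᵥ Qᵀ *ᵥ u ≗ u
  right-inverse u r = -1*p+q≡0⇒q≡p (u r) _ (transpose-injective difference Qᵀdifference≡0 r)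
    where
    difference : Vector ℚ n
    difference i = - 1ℚ * u i + (Q *ᵥ Qᵀ *ᵥ u) i

    Qᵀdifference≡0 : Qᵀ *ᵥ difference ≗ (λ _ → 0ℚ)
    Qᵀdifference≡0 j = begin
      (Qᵀ *ᵥ difference) j                         ≡⟨ *ᵥ-linear Qᵀ (- 1ℚ) u (Q *ᵥ Qᵀ *ᵥ u) j ⟩
      - 1ℚ * (Qᵀ *ᵥ u) j + (Qᵀ *ᵥ Q *ᵥ Qᵀ *ᵥ u) j  ≡⟨ cong (- 1ℚ * (Qᵀ *ᵥ u) j +_) (left-inverse (Qᵀ *ᵥ u) j) ⟩
      - 1ℚ * (Qᵀ *ᵥ u) j + (Qᵀ *ᵥ u) j             ≡⟨ -1*p+p≡0 ((Qᵀ *ᵥ u) j) ⟩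
      0ℚ                                           ∎
      where open ≡-Reasoning

walk : ∀ {n} → Mat ℚ n → ℕ → Vector ℚ n
walk M zero    = ones
walk M (suc k) = M *ᵥ walk M k

module OrthogonalSimilarity {n} (Q S S′ : Mat ℚ n)
  (orthogonal : ∀ i j → (transpose Q *ₘ Q) i j ≡ idMat i j)
  (regular : Q *ᵥ ones ≗ ones)
  (similar : ∀ i j → (transpose Q *ₘ S *ₘ Q) i j ≡ S′ i j) where

  open OrthogonalMatrix Q orthogonal

  transpose-intertwines : ∀ u → Qᵀ *ᵥ S *ᵥ u ≗ S′ *ᵥ Qᵀ *ᵥ u
  transpose-intertwines u j = begin
    (Qᵀ *ᵥ S *ᵥ u) j               ≡⟨ *ᵥ-cong Qᵀ (*ᵥ-cong S (λ r → sym (right-inverse u r))) j ⟩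
    (Qᵀ *ᵥ S *ᵥ Q *ᵥ Qᵀ *ᵥ u) j    ≡⟨ *ᵥ-assoc Qᵀ S (Q *ᵥ Qᵀ *ᵥ u) j ⟩
    ((Qᵀ *ₘ S) *ᵥ Q *ᵥ Qᵀ *ᵥ u) j  ≡⟨ *ᵥ-assoc (Qᵀ *ₘ S) Q (Qᵀ *ᵥ u) j ⟩
    ((Qᵀ *ₘ S *ₘ Q) *ᵥ Qᵀ *ᵥ u) j  ≡⟨ sum-cong-≗ (λ k → cong (_* (Qᵀ *ᵥ u) k) (similar j k)) ⟩
    (S′ *ᵥ Qᵀ *ᵥ u) j              ∎
    where open ≡-Reasoning

  transpose-walk : ∀ k → Qᵀ *ᵥ walk S k ≗ walk S′ k
  transpose-walk zero    j = trans (*ᵥ-cong Qᵀ (λ r → sym (regular r)) j) (left-inverse ones j)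
  transpose-walk (suc k) j = trans (transpose-intertwines (walk S k) j) (*ᵥ-cong S′ (transpose-walk k) j)

ι : ℤ → ℚ
ι a = a / 1

ι≡mkℚ : ∀ a → ι a ≡ ℚ.mkℚ a 0 (Coprime.sym (Coprime.1-coprimeTo ∣ a ∣))
ι≡mkℚ a = ℚP.↥p/↧p≡p _

ι-injective : ∀ {a b} → ι a ≡ ι b → a ≡ b
ι-injective {a} {b} eq = cong ↥_ (trans (sym (ι≡mkℚ a)) (trans eq (ι≡mkℚ b)))

ι-+ : ∀ a b → ι (a ℤ.+ b) ≡ ι a + ι b
ι-+ a b = sym (trans (cong₂ _+_ (ι≡mkℚ a) (ι≡mkℚ b))
  (ℚP./-cong {a ℤ.* ℤ.+ 1 ℤ.+ b ℤ.* ℤ.+ 1} {1} (cong₂ ℤ._+_ (ℤP.*-identityʳ a) (ℤP.*-identityʳ b)) refl))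

ι-* : ∀ a b → ι (a ℤ.* b) ≡ ι a * ι b
ι-* a b = sym (cong₂ _*_ (ι≡mkℚ a) (ι≡mkℚ b))

ι-integral : ∀ a → IsIntegral (ι a)
ι-integral a = cong ℚ.denominatorℕ (ι≡mkℚ a)

integral⇒ι↥≡ : ∀ q → IsIntegral q → ι (↥ q) ≡ q
integral⇒ι↥≡ (ℚ.mkℚ a zero _) refl = ℚP.↥p/↧p≡p _

ι-+-nonzero : ∀ p .{{_ : ℕ.NonZero p}} → ι (ℤ.+ p) ≢ 0ℚ
ι-+-nonzero p eq = ℕ.≢-nonZero⁻¹ p (ℤP.+-injective (ι-injective eq))

ι-sum : ∀ n (f : Vector ℤ n) → ι (Zm.sumFin n f) ≡ ∑[ i < n ] ι (f i)
ι-sum zero    f = refl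
ι-sum (suc n) f = trans (ι-+ (f zero) _) (cong (ι (f zero) +_) (ι-sum n (f ∘ suc)))

ι-walk : ∀ {n} k (M : Mat ℤ n) i → ι (Zm.powApply k M Zm.ones i) ≡ walk (toℚMat M) k i
ι-walk     zero    M i = refl
ι-walk {n} (suc k) M i = trans (ι-sum n (λ a → M i a ℤ.* Zm.powApply k M Zm.ones a))
  (sum-cong-≗ λ a → trans (ι-* (M i a) _) (cong (ι (M i a) *_) (ι-walk k M a)))

divisible⇒integral-quotient : ∀ q p .{{_ : ℕ.NonZero p}} x →
  IsIntegral (ι (ℤ.+ (q ℕ.* p)) * x) → p ∣ℤ (↥ (ι (ℤ.+ (q ℕ.* p)) * x)) → IsIntegral (ι (ℤ.+ q) * x)
divisible⇒integral-quotient q p x integral p∣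
  with ℤD.∣ᵤ⇒∣ {ℤ.+ p} {↥ (ι (ℤ.+ (q ℕ.* p)) * x)} p∣
... | ℤD.divides t ↥≡t*p = subst IsIntegral (sym qx≡t) (ι-integral t)
  where
  open ≡-Reasoning
  rotate : ∀ a b c → a * (b * c) ≡ (b * a) * c
  rotate = solve-∀ ℚ-ring

  qx≡t : ι (ℤ.+ q) * x ≡ ι t
  qx≡t = *-cancelˡ-≡ (ι (ℤ.+ p)) (ι-+-nonzero p) (begin
    ι (ℤ.+ p) * (ι (ℤ.+ q) * x)    ≡⟨ rotate (ι (ℤ.+ p)) (ι (ℤ.+ q)) x ⟩
    ι (ℤ.+ q) * ι (ℤ.+ p) * x      ≡⟨ cong (_* x) (sym (ι-* (ℤ.+ q) (ℤ.+ p))) ⟩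
    ι (ℤ.+ q ℤ.* ℤ.+ p) * x        ≡⟨ cong (λ a → ι a * x) (sym (ℤP.pos-* q p)) ⟩
    ι (ℤ.+ (q ℕ.* p)) * x          ≡⟨ sym (integral⇒ι↥≡ _ integral) ⟩
    ι (↥ (ι (ℤ.+ (q ℕ.* p)) * x))  ≡⟨ cong ι ↥≡t*p ⟩
    ι (t ℤ.* ℤ.+ p)                ≡⟨ trans (ι-* t (ℤ.+ p)) (ℚP.*-comm (ι t) (ι (ℤ.+ p))) ⟩
    ι (ℤ.+ p) * ι t                ∎)

level⇒indivisible-entry : ∀ {n} {Q : Mat ℚ n} {ℓ p} .{{_ : NonTrivial p}} → IsLevel Q ℓ → p ∣ ℓ →
  ∃₂ λ i j → ¬ p ∣ℤ (↥ (ι (ℤ.+ ℓ) * Q i j))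
level⇒indivisible-entry {n} {Q} {ℓ} {p} (0<ℓ , ℓQ-integral , ℓ-minimal) p∣ℓ
  with any? (λ i → any? (λ j → ¬? (p ℕD.∣? ∣ ↥ (ι (ℤ.+ ℓ) * Q i j) ∣)))
... | yes (i , j , p∤) = i , j , p∤
... | no  p∣all        = contradiction (ℓ-minimal q 0<q qQ-integral) (ℕP.<⇒≱ (ℕD.quotient-< p∣ℓ))
  where
  instance
    _ = ℕ.>-nonZero 0<ℓ
    _ = ℕ.nonTrivial⇒nonZero p
  q = ℕD.quotient p∣ℓ

  0<q : 0 ℕ.< q
  0<q = ℕ.>-nonZero⁻¹ q {{ℕD.quotient≢0 p∣ℓ}}

  p∣entry : ∀ i j → p ∣ℤ (↥ (ι (ℤ.+ ℓ) * Q i j))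
  p∣entry i j = decidable-stable (p ℕD.∣? _) (λ p∤ → p∣all (i , j , p∤))

  qQ-integral : ScaledIntegral q Q
  qQ-integral i j = divisible⇒integral-quotient q p (Q i j)
    (subst (λ m → IsIntegral (ι (ℤ.+ m) * Q i j)) (ℕD._∣_.equality p∣ℓ) (ℓQ-integral i j))
    (subst (λ m → p ∣ℤ (↥ (ι (ℤ.+ m) * Q i j))) (ℕD._∣_.equality p∣ℓ) (p∣entry i j))

sumFin≡sum : ∀ n (f : Vector ℚ n) → Qm.sumFin n f ≡ sum f
sumFin≡sum zero    f = refl
sumFin≡sum (suc n) f = cong (f zero +_) (sumFin≡sum n (f ∘ suc))

⊗≡*ₘ : ∀ {n} (M N : Mat ℚ n) i j → Qm._⊗_ M N i j ≡ (M *ₘ N) i j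
⊗≡*ₘ M N i j = sumFin≡sum _ (λ k → M i k * N k j)

Orthogonal⇒ᵀ*ₘ≡idMat : ∀ {n} (Q : Mat ℚ n) → Orthogonal Q → ∀ i j → (transpose Q *ₘ Q) i j ≡ idMat i j
Orthogonal⇒ᵀ*ₘ≡idMat Q orthogonal i j = trans (sym (⊗≡*ₘ (transpose Q) Q i j)) (orthogonal i j)

Regular⇒*ᵥones≗ones : ∀ {n} (Q : Mat ℚ n) → Regular Q → Q *ᵥ ones ≗ ones
Regular⇒*ᵥones≗ones {n} Q regular i = trans (sym (sumFin≡sum n (λ k → Q i k * 1ℚ))) (regular i)

conjugate-⊗≡*ₘ : ∀ {n} (Q S : Mat ℚ n) i j →
  Qm._⊗_ (Qm._⊗_ (transpose Q) S) Q i j ≡ (transpose Q *ₘ S *ₘ Q) i j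
conjugate-⊗≡*ₘ Q S i j = trans (⊗≡*ₘ (Qm._⊗_ (transpose Q) S) Q i j)
  (sum-cong-≗ λ k → cong (_* Q k j) (⊗≡*ₘ (transpose Q) S i k))

module IntegralWalks {n} (S S′ : Mat ℤ n) (Q : Mat ℚ n)
  (orthogonal : ∀ i j → (transpose Q *ₘ Q) i j ≡ idMat i j)
  (regular : Q *ᵥ ones ≗ ones)
  (similar : ∀ i j → (transpose Q *ₘ toℚMat S *ₘ Q) i j ≡ toℚMat S′ i j) where

  open OrthogonalSimilarity Q (toℚMat S) (toℚMat S′) orthogonal regular similar

  walk-transpose-scaled : ∀ ℓ (Z : Mat ℤ n) → (∀ i j → ι (Z i j) ≡ ι (ℤ.+ ℓ) * Q i j) → ∀ k j →
    Zm.sumFin n (λ a → Zm.powApply k S Zm.ones a ℤ.* Z a j) ≡ ℤ.+ ℓ ℤ.* Zm.powApply k S′ Zm.ones j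
  walk-transpose-scaled ℓ Z ιZ≡ℓQ k j = ι-injective (begin
    ι (Zm.sumFin n (λ a → Zm.powApply k S Zm.ones a ℤ.* Z a j))
      ≡⟨ ι-sum n (λ a → Zm.powApply k S Zm.ones a ℤ.* Z a j) ⟩
    ∑[ a < n ] ι (Zm.powApply k S Zm.ones a ℤ.* Z a j)
      ≡⟨ sum-cong-≗ (λ a → trans (ι-* (Zm.powApply k S Zm.ones a) (Z a j)) (cong₂ _*_ (ι-walk k S a) (ιZ≡ℓQ a j))) ⟩
    ∑[ a < n ] (walk (toℚMat S) k a * (ι ℓ′ * Q a j))
      ≡⟨ sum-cong-≗ (λ a → rotate (walk (toℚMat S) k a) (ι ℓ′) (Q a j)) ⟩
    ∑[ a < n ] (ι ℓ′ * (Q a j * walk (toℚMat S) k a))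
      ≡⟨ sym (*-distribˡ-sum (ι ℓ′) (λ a → Q a j * walk (toℚMat S) k a)) ⟩
    ι ℓ′ * (transpose Q *ᵥ walk (toℚMat S) k) j
      ≡⟨ cong (ι ℓ′ *_) (transpose-walk k j) ⟩
    ι ℓ′ * walk (toℚMat S′) k j
      ≡⟨ cong (ι ℓ′ *_) (sym (ι-walk k S′ j)) ⟩
    ι ℓ′ * ι (Zm.powApply k S′ Zm.ones j)
      ≡⟨ sym (ι-* ℓ′ (Zm.powApply k S′ Zm.ones j)) ⟩
    ι (ℓ′ ℤ.* Zm.powApply k S′ Zm.ones j) ∎)
    where
    open ≡-Reasoning
    ℓ′ = ℤ.+ ℓ
    rotate : ∀ w l q → w * (l * q) ≡ l * (q * w)
    rotate = solve-∀ ℚ-ring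

lemma3p2 : (n : ℕ) (Σ′ : OrientedGraph n) → InG n Σ′ →
    (Q : Mat ℚ n) → InQ Σ′ Q → (ℓ : ℕ) → IsLevel Q ℓ →
    (p : ℕ) → Prime p → p ∣ ℓ →
    Σ (Vec′ ℤ n) (λ z → ¬ (∀ i → p ∣ℤ z i) ×
      (∀ k → p ∣ℤ Zm._⊛_ (Zm.transpose (walkMat Σ′)) z k))
lemma3p2 n Σ′ _ Q (orthogonal , regular , Δ , _ , similar) ℓ level p (prime _) p∣ℓ =
  (λ a → ℓQ a j₀) , (λ p∣z → p∤ℓQᵢ₀ⱼ₀ (p∣z i₀)) , p∣Wᵀz
  where
  open IntegralWalks (skewAdj Σ′) (skewAdj Δ) Q (Orthogonal⇒ᵀ*ₘ≡idMat Q orthogonal) (Regular⇒*ᵥones≗ones Q regular)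
    (λ i j → trans (sym (conjugate-⊗≡*ₘ Q (toℚMat (skewAdj Σ′)) i j)) (similar i j))

  ℓQ : Mat ℤ n
  ℓQ i j = ↥ (ι (ℤ.+ ℓ) * Q i j)

  indivisible = level⇒indivisible-entry level p∣ℓ
  i₀ = proj₁ indivisible
  j₀ = proj₁ (proj₂ indivisible)
  p∤ℓQᵢ₀ⱼ₀ = proj₂ (proj₂ indivisible)

  p∣Wᵀz : ∀ k → p ∣ℤ Zm._⊛_ (Zm.transpose (walkMat Σ′)) (λ a → ℓQ a j₀) k
  p∣Wᵀz k = subst (p ∣ℤ_)
    (sym (walk-transpose-scaled ℓ ℓQ (λ i j → integral⇒ι↥≡ _ (proj₁ (proj₂ level) i j)) (toℕ k) j₀))
    (subst (p ∣_) (sym (ℤP.abs-* (ℤ.+ ℓ) _)) (ℕD.∣-trans p∣ℓ (ℕD.m∣m*n _)))
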